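{- Let $G=(V,E)$ be a finite simple graph and let $R\subseteq V$ be a nonempty set such that every $r\in R$ is incident to at least two pendant edges of $G$. Let $A=\{a\in V:\deg(a)=1 \text{ and } a \text{ is adjacent to a vertex of } R\}$. Then $Sb_{|A|-|R|}(G)=|A|-|R|$.
   Context: A pendant edge is an edge incident to a vertex of degree 1. $\gamma(G)$ is the domination number of $G$. For a positive integer $k$, $Sb_k(G)$ is the minimum size of a set $\mathcal{E}\subseteq E$ such that $\gamma(G-\mathcal{E})=\gamma(G)+k$. -}

module Defs where

open import Data.Nat using (ℕ; zero; suc; _+_; _≤_; _∸_; _≡ᵇ_)
open import Data.Bool using (Bool; true; false; _∧_; not; if_then_else_)
open import Data.Fin using (Fin; _<?_)
open import Data.Fin.Subset using (Subset; _∈_; ∣_∣)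
open import Data.List using (List; allFin; map)
open import Data.Nat.ListAction using (sum)
open import Data.Bool.ListAction using (any)
open import Data.Vec using (tabulate; lookup)
open import Data.Product using (Σ; ∃; _×_; _,_)
open import Data.Sum using (_⊎_)
open import Relation.Nullary using (¬_)
open import Relation.Nullary.Decidable using (⌊_⌋)
open import Relation.Binary.PropositionalEquality using (_≡_)

record Graph (n : ℕ) : Set where
  field
    adj    : Fin n → Fin n → Bool
    sym    : ∀ i j → adj i j ≡ adj j i
    irrefl : ∀ i → adj i i ≡ false
open Graph public

countV : {n : ℕ} → (Fin n → Bool) → ℕ
countV {n} p = sum (map (λ u → if p u then 1 else 0) (allFin n))

deg : {n : ℕ} → Graph n → Fin n → ℕ
deg G v = countV (adj G v)

-- A set of edges of G, represented as a symmetric Boolean relation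
-- contained in the adjacency relation of G (each edge {i,j} is recorded
-- both as (i,j) and (j,i)).
record EdgeSet {n : ℕ} (G : Graph n) : Set where
  field
    mem  : Fin n → Fin n → Bool
    symE : ∀ i j → mem i j ≡ mem j i
    sub  : ∀ i j → mem i j ≡ true → adj G i j ≡ true
open EdgeSet public

size : {n : ℕ} {G : Graph n} → EdgeSet G → ℕ
size {n} F = sum (map (λ i → countV (λ j → ⌊ i <? j ⌋ ∧ mem F i j)) (allFin n))

delete : {n : ℕ} (G : Graph n) → EdgeSet G → Graph n
delete G F = record
  { adj    = λ i j → adj G i j ∧ not (mem F i j)
  ; sym    = λ i j → cong₂' (sym G i j) (symE F i j)
  ; irrefl = λ i → irr (adj G i i) (irrefl G i)
  }
  where
  cong₂' : ∀ {a b c d} → a ≡ b → c ≡ d → a ∧ not c ≡ b ∧ not d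
  cong₂' _≡_.refl _≡_.refl = _≡_.refl
  irr : ∀ a {c} → a ≡ false → a ∧ not c ≡ false
  irr .false _≡_.refl = _≡_.refl

Dominating : {n : ℕ} → Graph n → Subset n → Set
Dominating {n} G D = ∀ v → v ∈ D ⊎ Σ (Fin n) (λ u → u ∈ D × adj G u v ≡ true)

IsDomNum : {n : ℕ} → Graph n → ℕ → Set
IsDomNum {n} G g =
  Σ (Subset n) (λ D → Dominating G D × ∣ D ∣ ≡ g)
  × (∀ D → Dominating G D → g ≤ ∣ D ∣)

IncreasesBy : {n : ℕ} (G : Graph n) → EdgeSet G → ℕ → Set
IncreasesBy G F k = Σ ℕ (λ g → IsDomNum G g × IsDomNum (delete G F) (g + k))

IsSb : {n : ℕ} → Graph n → ℕ → ℕ → Set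
IsSb G k m =
  Σ (EdgeSet G) (λ F → IncreasesBy G F k × size F ≡ m)
  × (∀ F → IncreasesBy G F k → m ≤ size F)

PendantEdge : {n : ℕ} → Graph n → Fin n → Fin n → Set
PendantEdge G r u = adj G r u ≡ true × (deg G r ≡ 1 ⊎ deg G u ≡ 1)

TwoPendant : {n : ℕ} → Graph n → Fin n → Set
TwoPendant {n} G r = Σ (Fin n) λ u₁ → Σ (Fin n) λ u₂ →
  ¬ (u₁ ≡ u₂) × PendantEdge G r u₁ × PendantEdge G r u₂

leavesOf : {n : ℕ} → Graph n → Subset n → Subset n
leavesOf {n} G R = tabulate λ a →
  (deg G a ≡ᵇ 1) ∧ any (λ r → lookup R r ∧ adj G a r) (allFin n)

{-# OPTIONS --safe #-}

-- Keep one pendant edge at each r ∈ R and delete the remaining pendant edges at the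
-- leaves of A; this is a set F of |A| − |R| edges, since every leaf of A hangs on exactly
-- one vertex of R. Deleting any edge set E raises γ by at most |E| (add the far endpoints
-- of the deleted edges leaving a dominating set), which is the lower bound on Sb.
-- Conversely, in G − F each cut-off leaf is isolated, so it lies in every dominating set
-- D′, and each r ∈ R outside D′ forces its kept leaf into D′; trading D′ ∩ A for R gives a
-- dominating set of G with at least |F| fewer vertices, so γ(G − F) = γ(G) + |F|.
module Submission where

open import Defs renaming (sym to adj-sym)
open import Data.Nat using (ℕ; zero; suc; _+_; _∸_; _≤_; z≤n; s≤s; _≡ᵇ_)
open import Data.Nat.Properties
  using ( +-0-commutativeMonoid; module ≤-Reasoning; ≤-refl; ≤-reflexive; ≤-trans; ≤-antisym; _≤?_; ≰⇒>
        ; 1+n≰n; m≤m+n; +-identityʳ; +-assoc; +-comm; +-mono-≤; +-monoˡ-≤; +-monoʳ-≤; +-cancelˡ-≤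
        ; m+n∸m≡n; ≡ᵇ⇒≡; ≡⇒≡ᵇ)
open import Data.Bool using (Bool; true; false; if_then_else_; _∧_; _∨_; not)
import Data.Bool.Properties as Bool
open import Data.Bool.Properties using (T-≡; ∨-zeroʳ; ∧-zeroʳ; ∧-identityʳ; ∧-assoc; ∧-comm)
open import Data.Bool.ListAction using (any)
open import Data.Fin using (Fin; zero; suc; punchIn; punchOut; _<?_)
open import Data.Fin.Properties using (_≟_; <-cmp; <-asym; punchInᵢ≢i; punchIn-punchOut; all?; any?)
open import Data.Fin.Subset using (Subset; _∈_; ∣_∣; ⊤)
open import Data.Fin.Subset.Properties using (_∈?_; anySubset?; ∈⊤; ∣⊤∣≡n)
open import Data.List using (allFin; map; tabulate)
open import Data.List.Properties using (map-tabulate)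
open import Data.List.Membership.Propositional using (lose)
open import Data.List.Membership.Propositional.Properties using (∈-allFin)
open import Data.List.Relation.Unary.Any using (satisfied)
open import Data.List.Relation.Unary.Any.Properties using (any⁺; any⁻)
open import Data.Nat.ListAction using (sum)
open import Data.Product using (Σ; _,_; _×_; proj₁; proj₂)
open import Data.Sum using (_⊎_; inj₁; inj₂)
open import Data.Vec using ([]; _∷_; lookup)
import Data.Vec as Vec
open import Data.Vec.Properties using (lookup∘tabulate; []=⇒lookup; lookup⇒[]=)
open import Function using (_∘_; _∘₂_)
open import Function.Bundles using (Equivalence)
open import Relation.Binary using (tri<; tri≈; tri>)
open import Relation.Binary.PropositionalEquality
open import Relation.Nullary using (yes; no; does; contradiction)
open import Relation.Nullary.Decidable using (⌊_⌋; _×-dec_; _⊎-dec_; dec-true; dec-false)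
open import Relation.Unary using (Decidable)
open import Algebra.Properties.CommutativeMonoid.Sum +-0-commutativeMonoid
  using (sum-remove; sum-cong-≗; sum-replicate-zero; ∑-distrib-+; ∑-comm)
  renaming (sum to ∑)

-- Finite sums and counting over Fin n

∧-true⁻ : ∀ a {b} → a ∧ b ≡ true → a ≡ true × b ≡ true
∧-true⁻ true {true} refl = refl , refl

∧-true⁺ : ∀ {a b} → a ≡ true → b ≡ true → a ∧ b ≡ true
∧-true⁺ refl refl = refl

∨-trueˡ : ∀ {a} b → a ≡ true → a ∨ b ≡ true
∨-trueˡ b refl = refl

∨-trueʳ : ∀ a {b} → b ≡ true → a ∨ b ≡ true
∨-trueʳ a refl = ∨-zeroʳ a

∑-mono-≤ : ∀ {n} {f g : Fin n → ℕ} → (∀ i → f i ≤ g i) → ∑ f ≤ ∑ g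
∑-mono-≤ {zero}  _   = z≤n
∑-mono-≤ {suc n} f≤g = +-mono-≤ (f≤g zero) (∑-mono-≤ (f≤g ∘ suc))

∑-≥-term : ∀ {n} (f : Fin n → ℕ) x → f x ≤ ∑ f
∑-≥-term {suc n} f x = ≤-trans (m≤m+n (f x) _) (≤-reflexive (sym (sum-remove f)))

∑-≥-two-terms : ∀ {n} (f : Fin n → ℕ) {x y} → x ≢ y → f x + f y ≤ ∑ f
∑-≥-two-terms {suc n} f {x} {y} x≢y = begin
  f x + f y                     ≡⟨ cong (λ z → f x + f z) (sym (punchIn-punchOut x≢y)) ⟩
  f x + f (punchIn x y′)        ≤⟨ +-monoʳ-≤ (f x) (∑-≥-term (f ∘ punchIn x) y′) ⟩
  f x + ∑ (f ∘ punchIn x)       ≡⟨ sym (sum-remove f) ⟩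
  ∑ f                           ∎
  where
  open ≤-Reasoning
  y′ = punchOut x≢y

∑-single : ∀ {n} (f : Fin n → ℕ) x → (∀ i → i ≢ x → f i ≡ 0) → ∑ f ≡ f x
∑-single {suc n} f x others = begin
  ∑ f                      ≡⟨ sum-remove f ⟩
  f x + ∑ (f ∘ punchIn x)  ≡⟨ cong (f x +_) (sum-cong-≗ (λ j → others _ (punchInᵢ≢i x j))) ⟩
  f x + ∑ {n} (λ _ → 0)    ≡⟨ cong (f x +_) (sum-replicate-zero n) ⟩
  f x + 0                  ≡⟨ +-identityʳ (f x) ⟩
  f x                      ∎
  where open ≡-Reasoning

toℕ : Bool → ℕ
toℕ b = if b then 1 else 0

count : ∀ {n} → (Fin n → Bool) → ℕ
count p = ∑ (toℕ ∘ p)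

list-sum-allFin : ∀ {n} (f : Fin n → ℕ) → sum (map f (allFin n)) ≡ ∑ f
list-sum-allFin {n} f = trans (cong sum (map-tabulate {n = n} (λ i → i) f)) (sum-tabulate f)
  where
  sum-tabulate : ∀ {n} (f : Fin n → ℕ) → sum (tabulate f) ≡ ∑ f
  sum-tabulate {zero}  f = refl
  sum-tabulate {suc n} f = cong (f zero +_) (sum-tabulate (f ∘ suc))

countV≡count : ∀ {n} (p : Fin n → Bool) → countV p ≡ count p
countV≡count p = list-sum-allFin (toℕ ∘ p)

∣∣≡count : ∀ {n} (D : Subset n) → ∣ D ∣ ≡ count (lookup D)
∣∣≡count []          = refl
∣∣≡count (true ∷ D)  = cong suc (∣∣≡count D)
∣∣≡count (false ∷ D) = ∣∣≡count D

count-cong : ∀ {n} {p q : Fin n → Bool} → (∀ i → p i ≡ q i) → count p ≡ count q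
count-cong p≗q = sum-cong-≗ (cong toℕ ∘ p≗q)

count-≥2 : ∀ {n} (p : Fin n → Bool) {x y} → x ≢ y → p x ≡ true → p y ≡ true → 2 ≤ count p
count-≥2 p {x} {y} x≢y px py =
  subst (_≤ count p) (cong₂ _+_ (cong toℕ px) (cong toℕ py)) (∑-≥-two-terms (toℕ ∘ p) x≢y)

count≡1⇒unique : ∀ {n} (p : Fin n → Bool) → count p ≡ 1 →
                 ∀ {x y} → p x ≡ true → p y ≡ true → x ≡ y
count≡1⇒unique p c≡1 {x} {y} px py with x ≟ y
... | yes x≡y = x≡y
... | no  x≢y = contradiction (subst (2 ≤_) c≡1 (count-≥2 p x≢y px py)) (1+n≰n)

count-single : ∀ {n} (p : Fin n → Bool) x → (∀ i → i ≢ x → p i ≡ false) → count p ≡ toℕ (p x)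
count-single p x others = ∑-single (toℕ ∘ p) x (cong toℕ ∘₂ others)

any-allFin⁻ : ∀ {n} (p : Fin n → Bool) → any p (allFin n) ≡ true → Σ (Fin n) (λ x → p x ≡ true)
any-allFin⁻ {n} p any≡true with satisfied (any⁻ p (allFin n) (Equivalence.from T-≡ any≡true))
... | x , px = x , Equivalence.to T-≡ px

any-allFin⁺ : ∀ {n} (p : Fin n → Bool) x → p x ≡ true → any p (allFin n) ≡ true
any-allFin⁺ p x px = Equivalence.to T-≡ (any⁺ p (lose (∈-allFin x) (Equivalence.from T-≡ px)))

toℕ-any≤count : ∀ {n} (p : Fin n → Bool) → toℕ (any p (allFin n)) ≤ count p
toℕ-any≤count {n} p with any p (allFin n) in any≡
... | false = z≤n
... | true with any-allFin⁻ p any≡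
...   | x , px = subst (_≤ count p) (cong toℕ px) (∑-≥-term (toℕ ∘ p) x)

count-false : ∀ {n} (p : Fin n → Bool) → (∀ i → p i ≡ false) → count p ≡ 0
count-false {n} p p≡false = trans (sum-cong-≗ (cong toℕ ∘ p≡false)) (sum-replicate-zero n)

count≡toℕ-any : ∀ {n} (p : Fin n → Bool) → (∀ {x y} → p x ≡ true → p y ≡ true → x ≡ y) →
                count p ≡ toℕ (any p (allFin n))
count≡toℕ-any {n} p unique with any p (allFin n) in any≡
... | true with any-allFin⁻ p any≡
...   | x , px = trans (count-single p x others) (cong toℕ px)
  where
  others : ∀ i → i ≢ x → p i ≡ false
  others i i≢x with p i in pi
  ... | true  = contradiction (unique pi px) i≢x
  ... | false = refl
count≡toℕ-any p unique | false = count-false p none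
  where
  none : ∀ i → p i ≡ false
  none i with p i in pi
  ... | true  = contradiction (trans (sym (any-allFin⁺ p i pi)) any≡) λ ()
  ... | false = refl

toℕ-mono : ∀ {a b} → (a ≡ true → b ≡ true) → toℕ a ≤ toℕ b
toℕ-mono {false} _   = z≤n
toℕ-mono {true}  a⇒b rewrite a⇒b refl = s≤s z≤n

count-mono : ∀ {n} {p q : Fin n → Bool} → (∀ i → p i ≡ true → q i ≡ true) → count p ≤ count q
count-mono p⇒q = ∑-mono-≤ (toℕ-mono ∘ p⇒q)

toℕ-∨-≤ : ∀ a b → toℕ (a ∨ b) ≤ toℕ a + toℕ b
toℕ-∨-≤ true  b = s≤s z≤n
toℕ-∨-≤ false b = ≤-refl

count-∨-≤ : ∀ {n} (p q : Fin n → Bool) → count (λ i → p i ∨ q i) ≤ count p + count q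
count-∨-≤ p q = ≤-trans (∑-mono-≤ (λ i → toℕ-∨-≤ (p i) (q i))) (≤-reflexive (∑-distrib-+ (toℕ ∘ p) (toℕ ∘ q)))

count-split : ∀ {n} (p q : Fin n → Bool) → count p ≡ count (λ i → p i ∧ q i) + count (λ i → p i ∧ not (q i))
count-split p q = trans (sum-cong-≗ (λ i → toℕ-split (p i) (q i)))
  (∑-distrib-+ (λ i → toℕ (p i ∧ q i)) (λ i → toℕ (p i ∧ not (q i))))
  where
  toℕ-split : ∀ a b → toℕ a ≡ toℕ (a ∧ b) + toℕ (a ∧ not b)
  toℕ-split false b     = refl
  toℕ-split true  true  = refl
  toℕ-split true  false = refl

countPairs : ∀ {n} → (Fin n → Fin n → Bool) → ℕ
countPairs W = ∑ (λ i → count (W i))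

_<ᵇ_ : ∀ {n} → Fin n → Fin n → Bool
i <ᵇ j = ⌊ i <? j ⌋

countPairs-split : ∀ {n} (W : Fin n → Fin n → Bool) → (∀ i → W i i ≡ false) →
  countPairs W ≡ ∑ (λ i → ∑ (λ j → toℕ (i <ᵇ j ∧ W i j) + toℕ (i <ᵇ j ∧ W j i)))
countPairs-split W irrefl = begin
  ∑ (λ i → ∑ (λ j → toℕ (W i j)))
    ≡⟨ sum-cong-≗ (λ i → trans (sum-cong-≗ (by-order i)) (∑-distrib-+ (λ j → toℕ (i <ᵇ j ∧ W i j)) _)) ⟩
  ∑ (λ i → ∑ (λ j → toℕ (i <ᵇ j ∧ W i j)) + ∑ (λ j → toℕ (j <ᵇ i ∧ W i j)))
    ≡⟨ ∑-distrib-+ (λ i → ∑ (λ j → toℕ (i <ᵇ j ∧ W i j))) _ ⟩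
  ∑ (λ i → ∑ (λ j → toℕ (i <ᵇ j ∧ W i j))) + ∑ (λ i → ∑ (λ j → toℕ (j <ᵇ i ∧ W i j)))
    ≡⟨ cong (∑ (λ i → ∑ (λ j → toℕ (i <ᵇ j ∧ W i j))) +_) (∑-comm (λ i j → toℕ (j <ᵇ i ∧ W i j))) ⟩
  ∑ (λ i → ∑ (λ j → toℕ (i <ᵇ j ∧ W i j))) + ∑ (λ i → ∑ (λ j → toℕ (i <ᵇ j ∧ W j i)))
    ≡⟨ sym (∑-distrib-+ (λ i → ∑ (λ j → toℕ (i <ᵇ j ∧ W i j))) _) ⟩
  ∑ (λ i → ∑ (λ j → toℕ (i <ᵇ j ∧ W i j)) + ∑ (λ j → toℕ (i <ᵇ j ∧ W j i)))
    ≡⟨ sum-cong-≗ (λ i → sym (∑-distrib-+ (λ j → toℕ (i <ᵇ j ∧ W i j)) _)) ⟩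
  ∑ (λ i → ∑ (λ j → toℕ (i <ᵇ j ∧ W i j) + toℕ (i <ᵇ j ∧ W j i)))
    ∎
  where
  open ≡-Reasoning
  by-order : ∀ i j → toℕ (W i j) ≡ toℕ (i <ᵇ j ∧ W i j) + toℕ (j <ᵇ i ∧ W i j)
  by-order i j with i <? j | j <? i
  ... | yes i<j | yes j<i = contradiction j<i (<-asym i<j)
  ... | yes _   | no _    = sym (+-identityʳ _)
  ... | no _    | yes _   = refl
  ... | no i≮j  | no j≮i with <-cmp i j
  ...   | tri< i<j _ _ = contradiction i<j i≮j
  ...   | tri> _ _ j<i = contradiction j<i j≮i
  ...   | tri≈ _ refl _ = cong toℕ (irrefl i)

toℕ-∧ˡ-≤ : ∀ l {a b c} → toℕ a + toℕ b ≤ toℕ c → toℕ (l ∧ a) + toℕ (l ∧ b) ≤ toℕ (l ∧ c)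
toℕ-∧ˡ-≤ false _     = z≤n
toℕ-∧ˡ-≤ true  a+b≤c = a+b≤c

toℕ-disjoint-≤ : ∀ {a b c} → (a ≡ true → c ≡ true) → (b ≡ true → c ≡ true) → (a ≡ true → b ≡ false) →
                 toℕ a + toℕ b ≤ toℕ c
toℕ-disjoint-≤ {false} _   b⇒c _ = toℕ-mono b⇒c
toℕ-disjoint-≤ {true}  a⇒c _   a⇒¬b rewrite a⇒c refl | a⇒¬b refl = ≤-refl

∈⇒true : ∀ {n} {D : Subset n} {x} → x ∈ D → lookup D x ≡ true
∈⇒true = []=⇒lookup

true⇒∈ : ∀ {n} {D : Subset n} {x} → lookup D x ≡ true → x ∈ D
true⇒∈ {D = D} {x} = lookup⇒[]= x D

∈-tabulate⁺ : ∀ {n} {p : Fin n → Bool} {x} → p x ≡ true → x ∈ Vec.tabulate p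
∈-tabulate⁺ {p = p} {x} px = true⇒∈ (trans (lookup∘tabulate p x) px)

∣tabulate∣≡count : ∀ {n} (p : Fin n → Bool) → ∣ Vec.tabulate p ∣ ≡ count p
∣tabulate∣≡count p = trans (∣∣≡count (Vec.tabulate p)) (count-cong (lookup∘tabulate p))

module _ {n} {P : Subset n → Set} (P? : Decidable P) where

  least-cardinality : ∀ m → Σ (Subset n) (λ D → P D × ∣ D ∣ ≤ m) →
                      Σ (Subset n) (λ D → P D × (∀ D′ → P D′ → ∣ D ∣ ≤ ∣ D′ ∣))
  least-cardinality zero    (D , PD , ∣D∣≤0) = D , PD , λ _ _ → ≤-trans ∣D∣≤0 z≤n
  least-cardinality (suc m) (D , PD , ∣D∣≤1+m) with anySubset? (λ D′ → P? D′ ×-dec (∣ D′ ∣ ≤? m))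
  ... | yes smaller = least-cardinality m smaller
  ... | no  none    = D , PD , λ D′ PD′ → ≤-trans ∣D∣≤1+m (≰⇒> (λ ∣D′∣≤m → none (D′ , PD′ , ∣D′∣≤m)))

dominating? : ∀ {n} (G : Graph n) → Decidable (Dominating G)
dominating? G D = all? λ v → (v ∈? D) ⊎-dec any? (λ u → (u ∈? D) ×-dec (adj G u v Bool.≟ true))

domination-number : ∀ {n} (G : Graph n) → Σ ℕ (IsDomNum G)
domination-number {n} G with least-cardinality (dominating? G) n (⊤ , (λ _ → inj₁ ∈⊤) , ≤-reflexive (∣⊤∣≡n n))
... | D , dom , minimal = ∣ D ∣ , (D , dom , refl) , minimal

-- Domination number and edge deletion

deg≡count : ∀ {n} (G : Graph n) v → deg G v ≡ count (adj G v)
deg≡count G v = countV≡count (adj G v)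

leaf-neighbour-unique : ∀ {n} (G : Graph n) {a x y} → deg G a ≡ 1 →
                        adj G a x ≡ true → adj G a y ≡ true → x ≡ y
leaf-neighbour-unique G {a} deg≡1 = count≡1⇒unique (adj G a) (trans (sym (deg≡count G a)) deg≡1)

module _ {n} {G : Graph n} (F : EdgeSet G) where

  size≡countPairs : size F ≡ countPairs (λ i j → i <ᵇ j ∧ mem F i j)
  size≡countPairs = trans (list-sum-allFin (λ i → countV (λ j → i <ᵇ j ∧ mem F i j)))
    (sum-cong-≗ {n} (λ i → countV≡count (λ j → i <ᵇ j ∧ mem F i j)))

  countPairs-≤-size : (W : Fin n → Fin n → Bool) → (∀ i j → W i j ≡ true → mem F i j ≡ true) →
                      (∀ i j → W i j ≡ true → W j i ≡ false) → countPairs W ≤ size F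
  countPairs-≤-size W W⊆F antisym = begin
    countPairs W                                                        ≡⟨ countPairs-split W irreflW ⟩
    ∑ (λ i → ∑ (λ j → toℕ (i <ᵇ j ∧ W i j) + toℕ (i <ᵇ j ∧ W j i)))   ≤⟨ ∑-mono-≤ (λ i → ∑-mono-≤ (pair i)) ⟩
    countPairs (λ i j → i <ᵇ j ∧ mem F i j)                            ≡⟨ sym size≡countPairs ⟩
    size F                                                              ∎
    where
    open ≤-Reasoning
    irreflW : ∀ i → W i i ≡ false
    irreflW i with W i i in wii
    ... | true  = contradiction (trans (sym (sub F i i (W⊆F i i wii))) (irrefl G i)) λ ()
    ... | false = refl
    pair : ∀ i j → toℕ (i <ᵇ j ∧ W i j) + toℕ (i <ᵇ j ∧ W j i) ≤ toℕ (i <ᵇ j ∧ mem F i j)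
    pair i j = toℕ-∧ˡ-≤ (i <ᵇ j)
      (toℕ-disjoint-≤ (W⊆F i j) (λ wji → trans (symE F i j) (W⊆F j i wji)) (antisym i j))

  size-≤-countPairs : (W : Fin n → Fin n → Bool) → (∀ i → W i i ≡ false) →
                      (∀ i j → mem F i j ≡ true → W i j ∨ W j i ≡ true) → size F ≤ countPairs W
  size-≤-countPairs W irreflW F⊆W∪Wᵀ = begin
    size F                                                              ≡⟨ size≡countPairs ⟩
    countPairs (λ i j → i <ᵇ j ∧ mem F i j)                            ≤⟨ ∑-mono-≤ (λ i → ∑-mono-≤ (pair i)) ⟩
    ∑ (λ i → ∑ (λ j → toℕ (i <ᵇ j ∧ W i j) + toℕ (i <ᵇ j ∧ W j i)))   ≡⟨ sym (countPairs-split W irreflW) ⟩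
    countPairs W                                                        ∎
    where
    open ≤-Reasoning
    pair : ∀ i j → toℕ (i <ᵇ j ∧ mem F i j) ≤ toℕ (i <ᵇ j ∧ W i j) + toℕ (i <ᵇ j ∧ W j i)
    pair i j with i <ᵇ j
    ... | false = z≤n
    ... | true  = ≤-trans (toℕ-mono (F⊆W∪Wᵀ i j)) (toℕ-∨-≤ (W i j) (W j i))

module _ {n} (G : Graph n) (F : EdgeSet G) where

  delete-dominating : ∀ D → Dominating G D →
    Σ (Subset n) λ D′ → Dominating (delete G F) D′ × ∣ D′ ∣ ≤ ∣ D ∣ + size F
  delete-dominating D dom = Vec.tabulate extended , dom′ , bound
    where
    inD : Fin n → Bool
    inD = lookup D
    exposed : Fin n → Bool
    exposed v = not (inD v) ∧ any (λ u → inD u ∧ mem F u v) (allFin n)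
    extended : Fin n → Bool
    extended v = inD v ∨ exposed v
    leaving : Fin n → Fin n → Bool
    leaving u v = inD u ∧ (not (inD v) ∧ mem F u v)

    exposed-by : ∀ {u v} → inD v ≡ false → inD u ≡ true → mem F u v ≡ true → exposed v ≡ true
    exposed-by {u} {v} v∉D u∈D uv∈F = subst (λ b → not b ∧ any (λ u → inD u ∧ mem F u v) (allFin n) ≡ true)
      (sym v∉D) (any-allFin⁺ (λ u → inD u ∧ mem F u v) u (∧-true⁺ u∈D uv∈F))

    dom′ : Dominating (delete G F) (Vec.tabulate extended)
    dom′ v with inD v in v∈D
    ... | true = inj₁ (∈-tabulate⁺ (∨-trueˡ (exposed v) v∈D))
    ... | false with dom v
    ...   | inj₁ v∈D′ = contradiction (trans (sym (∈⇒true v∈D′)) v∈D) λ ()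
    ...   | inj₂ (u , u∈D , uv) with mem F u v in uv∈F
    ...     | true  = inj₁ (∈-tabulate⁺ (∨-trueʳ (inD v) (exposed-by v∈D (∈⇒true u∈D) uv∈F)))
    ...     | false = inj₂ (u , ∈-tabulate⁺ (∨-trueˡ (exposed u) (∈⇒true u∈D)) , cong₂ (λ a e → a ∧ not e) uv uv∈F)

    exposed≤ : ∀ v → toℕ (exposed v) ≤ count (λ u → leaving u v)
    exposed≤ v with inD v
    ... | true  = z≤n
    ... | false = toℕ-any≤count (λ u → inD u ∧ mem F u v)

    bound : ∣ Vec.tabulate extended ∣ ≤ ∣ D ∣ + size F
    bound = begin
      ∣ Vec.tabulate extended ∣
        ≡⟨ ∣tabulate∣≡count extended ⟩
      count extended
        ≤⟨ count-∨-≤ inD exposed ⟩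
      count inD + count exposed
        ≤⟨ +-monoʳ-≤ (count inD) (∑-mono-≤ exposed≤) ⟩
      count inD + ∑ (λ v → count (λ u → leaving u v))
        ≡⟨ cong₂ _+_ (sym (∣∣≡count D)) (∑-comm (λ v u → toℕ (leaving u v))) ⟩
      ∣ D ∣ + countPairs leaving
        ≤⟨ +-monoʳ-≤ ∣ D ∣ (countPairs-≤-size F leaving leaving⊆F antisym) ⟩
      ∣ D ∣ + size F
        ∎
      where
      open ≤-Reasoning
      leaving⊆F : ∀ u v → leaving u v ≡ true → mem F u v ≡ true
      leaving⊆F u v uv-leaves = proj₂ (∧-true⁻ (not (inD v)) (proj₂ (∧-true⁻ (inD u) uv-leaves)))
      antisym : ∀ u v → leaving u v ≡ true → leaving v u ≡ false
      antisym u v uv-leaves = trans (cong (λ b → inD v ∧ (not b ∧ mem F v u)) (proj₁ (∧-true⁻ (inD u) uv-leaves))) (∧-zeroʳ (inD v))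

  domination-delete-≤ : ∀ {g h} → IsDomNum G g → IsDomNum (delete G F) h → h ≤ g + size F
  domination-delete-≤ ((D , dom , ∣D∣≡g) , _) (_ , minimal) with delete-dominating D dom
  ... | D′ , dom′ , ∣D′∣≤ = ≤-trans (minimal D′ dom′) (subst (λ m → ∣ D′ ∣ ≤ m + size F) ∣D∣≡g ∣D′∣≤)

  increase-≤-size : ∀ {k} → IncreasesBy G F k → k ≤ size F
  increase-≤-size (g , γG , γG-F) = +-cancelˡ-≤ g _ _ (domination-delete-≤ γG γG-F)

-- The edge set F at the pendant vertices of R

module Pendants {n} (G : Graph n) (R : Subset n) (two-pendants : ∀ r → r ∈ R → TwoPendant G r) where

  inR : Fin n → Bool
  inR = lookup R

  isLeaf : Fin n → Bool
  isLeaf a = deg G a ≡ᵇ 1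

  deg≡1⇒isLeaf : ∀ {a} → deg G a ≡ 1 → isLeaf a ≡ true
  deg≡1⇒isLeaf {a} deg≡1 = Equivalence.to T-≡ (≡⇒≡ᵇ (deg G a) 1 deg≡1)

  isLeaf⇒deg≡1 : ∀ {a} → isLeaf a ≡ true → deg G a ≡ 1
  isLeaf⇒deg≡1 {a} leaf = ≡ᵇ⇒≡ (deg G a) 1 (Equivalence.from T-≡ leaf)

  inR⇒2≤deg : ∀ {r} → inR r ≡ true → 2 ≤ deg G r
  inR⇒2≤deg {r} r∈R with two-pendants r (true⇒∈ r∈R)
  ... | u₁ , u₂ , u₁≢u₂ , (ru₁ , _) , (ru₂ , _) =
    subst (2 ≤_) (sym (deg≡count G r)) (count-≥2 (adj G r) u₁≢u₂ ru₁ ru₂)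

  inR⇒deg≢1 : ∀ {r} → inR r ≡ true → deg G r ≢ 1
  inR⇒deg≢1 r∈R deg≡1 = 1+n≰n (subst (2 ≤_) deg≡1 (inR⇒2≤deg r∈R))

  inR⇒¬isLeaf : ∀ {r} → inR r ≡ true → isLeaf r ≡ false
  inR⇒¬isLeaf {r} r∈R with isLeaf r in leaf
  ... | true  = contradiction (isLeaf⇒deg≡1 leaf) (inR⇒deg≢1 r∈R)
  ... | false = refl

  keep : Fin n → Fin n
  keep r with r ∈? R
  ... | yes r∈R = proj₁ (two-pendants r r∈R)
  ... | no  _   = r

  keep-pendant : ∀ {r} → inR r ≡ true → adj G (keep r) r ≡ true × deg G (keep r) ≡ 1
  keep-pendant {r} r∈R with r ∈? R
  ... | no r∉R = contradiction (true⇒∈ r∈R) r∉R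
  ... | yes r∈R′ with two-pendants r r∈R′
  ...   | _ , _ , _ , (ru , inj₂ deg≡1) , _ = trans (adj-sym G _ r) ru , deg≡1
  ...   | _ , _ , _ , (_  , inj₁ deg≡1) , _ = contradiction deg≡1 (inR⇒deg≢1 r∈R)

  hangs : Fin n → Fin n → Bool
  hangs a r = isLeaf a ∧ (inR r ∧ adj G a r)

  hangs⁻ : ∀ {a r} → hangs a r ≡ true → deg G a ≡ 1 × inR r ≡ true × adj G a r ≡ true
  hangs⁻ {a} {r} h with ∧-true⁻ (isLeaf a) h
  ... | leaf , rest = isLeaf⇒deg≡1 leaf , ∧-true⁻ (inR r) rest

  inA : Fin n → Bool
  inA a = isLeaf a ∧ any (λ r → inR r ∧ adj G a r) (allFin n)

  cut : Fin n → Fin n → Bool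
  cut a r = hangs a r ∧ not (does (a ≟ keep r))

  cut⇒hangs : ∀ {a r} → cut a r ≡ true → hangs a r ≡ true
  cut⇒hangs {a} {r} c = proj₁ (∧-true⁻ (hangs a r) c)

  F : EdgeSet G
  F = record
    { mem  = λ i j → cut i j ∨ cut j i
    ; symE = λ i j → Bool.∨-comm (cut i j) (cut j i)
    ; sub  = cut-sub
    }
    where
    cut-sub : ∀ i j → cut i j ∨ cut j i ≡ true → adj G i j ≡ true
    cut-sub i j cutij∨cutji with cut i j in cutij
    ... | true  = proj₂ (proj₂ (hangs⁻ (cut⇒hangs cutij)))
    ... | false = trans (adj-sym G i j) (proj₂ (proj₂ (hangs⁻ (cut⇒hangs cutij∨cutji))))

  cuts : ℕ
  cuts = ∑ (λ r → count (λ a → cut a r))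

  inA⁻ : ∀ {a} → inA a ≡ true → Σ (Fin n) (λ r → hangs a r ≡ true)
  inA⁻ {a} a∈A with ∧-true⁻ (isLeaf a) a∈A
  ... | leaf , some with any-allFin⁻ (λ r → inR r ∧ adj G a r) some
  ...   | r , rest = r , ∧-true⁺ leaf rest

  cut-irrefl : ∀ a → cut a a ≡ false
  cut-irrefl a with cut a a in c
  ... | true  = contradiction (proj₁ (hangs⁻ (cut⇒hangs c))) (inR⇒deg≢1 (proj₁ (proj₂ (hangs⁻ (cut⇒hangs c)))))
  ... | false = refl

  size≤cuts : size F ≤ cuts
  size≤cuts = ≤-trans (size-≤-countPairs F cut cut-irrefl (λ _ _ m → m)) (≤-reflexive (∑-comm (λ a r → toℕ (cut a r))))

  hangs-keep : ∀ r → hangs (keep r) r ≡ inR r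
  hangs-keep r with inR r in r∈R
  ... | true  = ∧-true⁺ (deg≡1⇒isLeaf (proj₂ (keep-pendant r∈R))) (proj₁ (keep-pendant r∈R))
  ... | false = ∧-zeroʳ (isLeaf (keep r))

  count-hangs : ∀ (d : Fin n → Bool) r →
    count (λ a → d a ∧ hangs a r) ≡ toℕ (inR r ∧ d (keep r)) + count (λ a → d a ∧ cut a r)
  count-hangs d r = begin
    count (λ a → d a ∧ hangs a r)
      ≡⟨ count-split (λ a → d a ∧ hangs a r) (λ a → does (a ≟ keep r)) ⟩
    count (λ a → (d a ∧ hangs a r) ∧ does (a ≟ keep r)) + count (λ a → (d a ∧ hangs a r) ∧ not (does (a ≟ keep r)))
      ≡⟨ cong₂ _+_ kept (count-cong (λ a → ∧-assoc (d a) (hangs a r) _)) ⟩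
    toℕ (inR r ∧ d (keep r)) + count (λ a → d a ∧ cut a r)
      ∎
    where
    open ≡-Reasoning
    k : Fin n
    k = keep r
    kept : count (λ a → (d a ∧ hangs a r) ∧ does (a ≟ k)) ≡ toℕ (inR r ∧ d k)
    kept = trans
      (count-single _ k (λ a a≢k → trans (cong ((d a ∧ hangs a r) ∧_) (dec-false (a ≟ k) a≢k)) (∧-zeroʳ _)))
      (cong toℕ (begin
        (d k ∧ hangs k r) ∧ does (k ≟ k)  ≡⟨ cong ((d k ∧ hangs k r) ∧_) (dec-true (k ≟ k) refl) ⟩
        (d k ∧ hangs k r) ∧ true          ≡⟨ ∧-identityʳ _ ⟩
        d k ∧ hangs k r                   ≡⟨ cong (d k ∧_) (hangs-keep r) ⟩
        d k ∧ inR r                       ≡⟨ ∧-comm (d k) (inR r) ⟩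
        inR r ∧ d k                       ∎))

  toℕ-inA : ∀ a → toℕ (inA a) ≡ count (hangs a)
  toℕ-inA a with isLeaf a in leaf
  ... | false = sym (count-false {n} (λ _ → false) (λ _ → refl))
  ... | true  = sym (count≡toℕ-any (λ r → inR r ∧ adj G a r) unique)
    where
    unique : ∀ {x y} → inR x ∧ adj G a x ≡ true → inR y ∧ adj G a y ≡ true → x ≡ y
    unique {x} {y} ax ay = leaf-neighbour-unique G (isLeaf⇒deg≡1 leaf)
                             (proj₂ (∧-true⁻ (inR x) ax)) (proj₂ (∧-true⁻ (inR y) ay))

  count-inA : ∀ (d : Fin n → Bool) →
    count (λ a → d a ∧ inA a) ≡ ∑ (λ r → toℕ (inR r ∧ d (keep r)) + count (λ a → d a ∧ cut a r))
  count-inA d = begin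
    count (λ a → d a ∧ inA a)                 ≡⟨ sum-cong-≗ toℕ-∧-inA ⟩
    ∑ (λ a → count (λ r → d a ∧ hangs a r))   ≡⟨ ∑-comm (λ a r → toℕ (d a ∧ hangs a r)) ⟩
    ∑ (λ r → count (λ a → d a ∧ hangs a r))   ≡⟨ sum-cong-≗ (count-hangs d) ⟩
    ∑ (λ r → toℕ (inR r ∧ d (keep r)) + count (λ a → d a ∧ cut a r)) ∎
    where
    open ≡-Reasoning
    toℕ-∧-inA : ∀ a → toℕ (d a ∧ inA a) ≡ count (λ r → d a ∧ hangs a r)
    toℕ-∧-inA a with d a
    ... | false = sym (count-false {n} (λ _ → false) (λ _ → refl))
    ... | true  = toℕ-inA a

  ∣A∣≡∣R∣+cuts : ∣ leavesOf G R ∣ ≡ ∣ R ∣ + cuts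
  ∣A∣≡∣R∣+cuts = begin
    ∣ leavesOf G R ∣                                        ≡⟨ ∣tabulate∣≡count inA ⟩
    count (λ a → true ∧ inA a)                              ≡⟨ count-inA (λ _ → true) ⟩
    ∑ (λ r → toℕ (inR r ∧ true) + count (λ a → cut a r))   ≡⟨ ∑-distrib-+ (λ r → toℕ (inR r ∧ true)) _ ⟩
    count (λ r → inR r ∧ true) + cuts                       ≡⟨ cong (_+ cuts) (count-cong (λ r → ∧-identityʳ (inR r))) ⟩
    count inR + cuts                                        ≡⟨ cong (_+ cuts) (sym (∣∣≡count R)) ⟩
    ∣ R ∣ + cuts                                            ∎
    where open ≡-Reasoning

  module _ (D′ : Subset n) (dom′ : Dominating (delete G F) D′) where

    private
      d : Fin n → Bool
      d = lookup D′

    leaf-dominated : ∀ {a r} → deg G a ≡ 1 → adj G a r ≡ true →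
                     d a ≡ true ⊎ (d r ≡ true × mem F r a ≡ false)
    leaf-dominated {a} deg≡1 ar with dom′ a
    ... | inj₁ a∈D′ = inj₁ (∈⇒true a∈D′)
    ... | inj₂ (u , u∈D′ , ua) with ∧-true⁻ (adj G u a) ua
    ...   | ua-G , ua∉F with leaf-neighbour-unique G deg≡1 (trans (adj-sym G a u) ua-G) ar
    ...     | refl = inj₂ (∈⇒true u∈D′ , Bool.not-injective ua∉F)

    cut-dominated : ∀ {a r} → cut a r ≡ true → d a ≡ true
    cut-dominated {a} {r} c with hangs⁻ (cut⇒hangs c)
    ... | deg≡1 , _ , ar with leaf-dominated deg≡1 ar
    ...   | inj₁ da        = da
    ...   | inj₂ (_ , ra∉F) = contradiction (trans (sym ra∉F) (∨-trueʳ (cut r a) c)) λ ()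

    keep-dominated : ∀ {r} → inR r ≡ true → d r ≡ false → d (keep r) ≡ true
    keep-dominated r∈R r∉D′ with keep-pendant r∈R
    ... | kr , deg≡1 with leaf-dominated deg≡1 kr
    ...   | inj₁ dk       = dk
    ...   | inj₂ (dr , _) = contradiction (trans (sym dr) r∉D′) λ ()

    dominator : Fin n → Bool
    dominator v = (d v ∧ not (inA v)) ∨ (inR v ∧ not (d v))

    inR⇒dominator : ∀ {r} → inR r ≡ true → dominator r ≡ true
    inR⇒dominator {r} r∈R with d r
    ... | true  = ∨-trueˡ _ (cong (λ b → not (b ∧ any (λ r′ → inR r′ ∧ adj G r r′) (allFin n))) (inR⇒¬isLeaf r∈R))
    ... | false = trans (∧-identityʳ (inR r)) r∈R

    dominator-dominating : Dominating G (Vec.tabulate dominator)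
    dominator-dominating v with inR v in v∈R
    ... | true  = inj₁ (∈-tabulate⁺ (inR⇒dominator v∈R))
    ... | false with inA v in v∈A
    ...   | true with inA⁻ v∈A
    ...     | r , vr with hangs⁻ vr
    ...       | _ , r∈R , vr-G = inj₂ (r , ∈-tabulate⁺ (inR⇒dominator r∈R) , trans (adj-sym G r v) vr-G)
    dominator-dominating v | false | false with dom′ v
    ... | inj₁ v∈D′ = inj₁ (∈-tabulate⁺ (∨-trueˡ _ (∧-true⁺ (∈⇒true v∈D′) (cong not v∈A))))
    ... | inj₂ (u , u∈D′ , uv) with inA u in u∈A
    ...   | false = inj₂ (u , ∈-tabulate⁺ (∨-trueˡ _ (∧-true⁺ (∈⇒true u∈D′) (cong not u∈A))) ,
                         proj₁ (∧-true⁻ (adj G u v) uv))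
    ...   | true with inA⁻ u∈A
    ...     | r , ur with hangs⁻ ur
    ...       | deg≡1 , r∈R , ur-G with leaf-neighbour-unique G deg≡1 (proj₁ (∧-true⁻ (adj G u v) uv)) ur-G
    ...         | refl = contradiction (trans (sym r∈R) v∈R) λ ()

    dominator-bound : ∣ Vec.tabulate dominator ∣ + cuts ≤ ∣ D′ ∣
    dominator-bound = begin
      ∣ Vec.tabulate dominator ∣ + cuts
        ≡⟨ cong (_+ cuts) (∣tabulate∣≡count dominator) ⟩
      count dominator + cuts
        ≤⟨ +-monoˡ-≤ cuts (count-∨-≤ (λ v → d v ∧ not (inA v)) (λ v → inR v ∧ not (d v))) ⟩
      count d∖A + count (λ r → inR r ∧ not (d r)) + cuts
        ≡⟨ +-assoc (count d∖A) _ cuts ⟩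
      count d∖A + (count (λ r → inR r ∧ not (d r)) + cuts)
        ≡⟨ cong (count d∖A +_) (sym (∑-distrib-+ (λ r → toℕ (inR r ∧ not (d r))) _)) ⟩
      count d∖A + ∑ (λ r → toℕ (inR r ∧ not (d r)) + count (λ a → cut a r))
        ≤⟨ +-monoʳ-≤ (count d∖A) (∑-mono-≤ per-centre) ⟩
      count d∖A + ∑ (λ r → toℕ (inR r ∧ d (keep r)) + count (λ a → d a ∧ cut a r))
        ≡⟨ cong (count d∖A +_) (sym (count-inA d)) ⟩
      count d∖A + count (λ a → d a ∧ inA a)
        ≡⟨ trans (+-comm (count d∖A) _) (sym (count-split d inA)) ⟩
      count d
        ≡⟨ sym (∣∣≡count D′) ⟩
      ∣ D′ ∣ ∎
      where
      open ≤-Reasoning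
      d∖A : Fin n → Bool
      d∖A v = d v ∧ not (inA v)
      per-centre : ∀ r → toℕ (inR r ∧ not (d r)) + count (λ a → cut a r)
                       ≤ toℕ (inR r ∧ d (keep r)) + count (λ a → d a ∧ cut a r)
      per-centre r = +-mono-≤
        (toℕ-mono (λ e → let r∈R , r∉D′ = ∧-true⁻ (inR r) e
                         in ∧-true⁺ r∈R (keep-dominated r∈R (Bool.not-injective r∉D′))))
        (count-mono {p = λ a → cut a r} (λ a c → ∧-true⁺ (cut-dominated c) c))

  domination-delete-≥ : ∀ {g h} → IsDomNum G g → IsDomNum (delete G F) h → g + cuts ≤ h
  domination-delete-≥ (_ , minimal) ((D′ , dom′ , ∣D′∣≡h) , _) =
    ≤-trans (+-monoˡ-≤ cuts (minimal _ (dominator-dominating D′ dom′)))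
            (subst (_ ≤_) ∣D′∣≡h (dominator-bound D′ dom′))

  F-increases-by-cuts : size F ≡ cuts × IncreasesBy G F cuts
  F-increases-by-cuts with domination-number G | domination-number (delete G F)
  ... | g , γG | h , γG-F = size≡cuts , g , γG , subst (IsDomNum (delete G F)) h≡g+cuts γG-F
    where
    h≤g+size : h ≤ g + size F
    h≤g+size = domination-delete-≤ G F γG γG-F
    g+cuts≤h : g + cuts ≤ h
    g+cuts≤h = domination-delete-≥ γG γG-F
    size≡cuts : size F ≡ cuts
    size≡cuts = ≤-antisym size≤cuts (+-cancelˡ-≤ g _ _ (≤-trans g+cuts≤h h≤g+size))
    h≡g+cuts : h ≡ g + cuts
    h≡g+cuts = ≤-antisym (subst (λ m → h ≤ g + m) size≡cuts h≤g+size) g+cuts≤h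

corollary1 : (n : ℕ) (G : Graph n) (R : Subset n) →
    Σ (Fin n) (λ r → r ∈ R) →
    (∀ r → r ∈ R → TwoPendant G r) →
    IsSb G (∣ leavesOf G R ∣ ∸ ∣ R ∣) (∣ leavesOf G R ∣ ∸ ∣ R ∣)
corollary1 n G R _ two-pendants =
  (F , subst (IncreasesBy G F) (sym k≡cuts) increases , trans size≡cuts (sym k≡cuts)) ,
  λ F′ → increase-≤-size G F′
  where
  open Pendants G R two-pendants
  size≡cuts : size F ≡ cuts
  size≡cuts = proj₁ F-increases-by-cuts
  increases : IncreasesBy G F cuts
  increases = proj₂ F-increases-by-cuts
  k≡cuts : ∣ leavesOf G R ∣ ∸ ∣ R ∣ ≡ cuts
  k≡cuts = trans (cong (_∸ ∣ R ∣) ∣A∣≡∣R∣+cuts) (m+n∸m≡n ∣ R ∣ cuts)
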